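{- Let $G=(V,E)$ be a graph, $U\subseteq V$, and let $G^+$ be the clique lift of $U$ from $G$. Then the stable set polytope $P(G)$ is the image of $P(G^+)$ under the linear map $p:\mathbb{R}^{(V\setminus U)\cup\lambda(U)}\to\mathbb{R}^V$ given by $p_v(x)=\sum_{S\text{ stable in }G_U,\ S\ni v}x_{\ell_S}$ for $v\in U$ and $p_v(x)=x_v$ for $v\in V\setminus U$.
   Context: The clique lift of $U$ from $G$ is the graph obtained by deleting $U$ from $G$ and adding a clique with node set $\lambda(U)=\{\ell_S: S \text{ a stable set of } G_U\}$ of new nodes, where each $\ell_S$ is joined to every node of $N_G(S)\setminus U$ ($N_G(S)$ being the set of nodes outside $S$ with a neighbor in $S$). $P(H)$ denotes the convex hull of characteristic vectors of stable sets of $H$.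
   Formalization: The map $p$ and the stable set polytopes $P(G)$ and $P(G^+)$ are taken over ℚ rather than ℝ, with rational points and rational convex-combination coefficients. -}

module Defs where

open import Data.Bool using (Bool; true; false; if_then_else_)
open import Data.Nat using (ℕ; zero; suc)
open import Data.Fin using (Fin)
open import Data.Fin.Subset using (Subset; _∈_; _∉_; _⊆_; inside; outside)
open import Data.Fin.Subset.Properties using (_∈?_; _⊆?_)
open import Data.Fin.Properties using (all?)
open import Data.List using (List; []; _∷_; map; concatMap; foldr)
open import Data.List.Relation.Unary.All using (All)
open import Data.Vec using (_∷_; [])
open import Data.Product using (Σ; ∃; _×_; _,_; proj₁; proj₂)
open import Data.Sum using (_⊎_; inj₁; inj₂)
open import Data.Rational using (ℚ; 0ℚ; 1ℚ; _+_; _*_; _≤_)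
open import Relation.Nullary using (¬_; Dec; yes; no)
open import Relation.Nullary.Decidable using (True; False; _×-dec_; _→-dec_; fromWitness; fromWitnessFalse)
open import Relation.Binary.PropositionalEquality using (_≡_; _≢_)
open import Data.Bool.Properties using () renaming (_≟_ to _≟ᵇ_)

record Graph (n : ℕ) : Set where
  field
    adj    : Fin n → Fin n → Bool
    sym    : ∀ u v → adj u v ≡ adj v u
    irrefl : ∀ v → adj v v ≡ false

open Graph public

IsStable : {A : Set} → (A → A → Set) → (A → Bool) → Set
IsStable {A} Adj T = ∀ a b → T a ≡ true → T b ≡ true → ¬ Adj a b

χ : {A : Set} → (A → Bool) → A → ℚ
χ T a = if T a then 1ℚ else 0ℚ

StableSet : {A : Set} → (A → A → Set) → Set
StableSet {A} Adj = Σ (A → Bool) (IsStable Adj)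

-- Stable set polytope, rational points: x is a convex combination
-- (nonnegative rational coefficients summing to 1) of finitely many
-- characteristic vectors of stable sets.
sumCoeff : {B : Set} → List (ℚ × B) → ℚ
sumCoeff = foldr (λ p r → proj₁ p + r) 0ℚ

combo : {A : Set} {Adj : A → A → Set} → List (ℚ × StableSet Adj) → A → ℚ
combo L a = foldr (λ p r → proj₁ p * χ (proj₁ (proj₂ p)) a + r) 0ℚ L

InP : {A : Set} → (A → A → Set) → (A → ℚ) → Set
InP {A} Adj x =
  Σ (List (ℚ × StableSet Adj)) λ L →
    All (λ p → 0ℚ ≤ proj₁ p) L × sumCoeff L ≡ 1ℚ × (∀ a → x a ≡ combo L a)

AdjG : {n : ℕ} → Graph n → Fin n → Fin n → Set
AdjG G u v = adj G u v ≡ true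

P : {n : ℕ} → Graph n → (Fin n → ℚ) → Set
P G = InP (AdjG G)

-- Stable sets of the induced subgraph G_U: subsets S ⊆ U, stable in G.

IsStableIn : {n : ℕ} → Graph n → Subset n → Subset n → Set
IsStableIn G U S = S ⊆ U × (∀ u v → u ∈ S → v ∈ S → adj G u v ≡ false)

isStableIn? : {n : ℕ} (G : Graph n) (U S : Subset n) → Dec (IsStableIn G U S)
isStableIn? G U S =
  (S ⊆? U) ×-dec all? (λ u → all? (λ v →
      (u ∈? S) →-dec ((v ∈? S) →-dec (adj G u v ≟ᵇ false))))

-- Clique lift of U from G.  Node set: (V ∖ U) ⊎ λ(U), where
-- λ(U) = { ℓ_S : S stable set of G_U } (one node per such subset S;
-- the proof component is a proof-irrelevant `True` witness).

OutU : {n : ℕ} → Subset n → Set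
OutU U = Σ (Fin _) λ v → False (v ∈? U)

LamU : {n : ℕ} → Graph n → Subset n → Set
LamU G U = Σ (Subset _) λ S → True (isStableIn? G U S)

Node⁺ : {n : ℕ} → Graph n → Subset n → Set
Node⁺ G U = OutU U ⊎ LamU G U

-- N_G(S) ∖ U membership for v ∉ U: v has a neighbour in S
-- (v ∉ S holds automatically since S ⊆ U and v ∉ U).
Adj⁺ : {n : ℕ} (G : Graph n) (U : Subset n) → Node⁺ G U → Node⁺ G U → Set
Adj⁺ G U (inj₁ (u , _)) (inj₁ (v , _)) = adj G u v ≡ true
Adj⁺ G U (inj₂ (S , _)) (inj₂ (T , _)) = S ≢ T
Adj⁺ G U (inj₂ (S , _)) (inj₁ (v , _)) = ∃ λ s → s ∈ S × adj G s v ≡ true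
Adj⁺ G U (inj₁ (v , _)) (inj₂ (S , _)) = ∃ λ s → s ∈ S × adj G s v ≡ true

P⁺ : {n : ℕ} (G : Graph n) (U : Subset n) → (Node⁺ G U → ℚ) → Set
P⁺ G U = InP (Adj⁺ G U)

allSubsets : (n : ℕ) → List (Subset n)
allSubsets zero    = [] ∷ []
allSubsets (suc n) = concatMap (λ S → (outside ∷ S) ∷ (inside ∷ S) ∷ []) (allSubsets n)

term : {n : ℕ} (G : Graph n) (U : Subset n) → (Node⁺ G U → ℚ) →
       Fin n → Subset n → ℚ
term G U x v S with isStableIn? G U S | v ∈? S
... | yes st | yes _ = x (inj₂ (S , fromWitness st))
... | yes _  | no _  = 0ℚ
... | no _   | _     = 0ℚ

p : {n : ℕ} (G : Graph n) (U : Subset n) → (Node⁺ G U → ℚ) → Fin n → ℚ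
p G U x v with v ∈? U
... | yes _  = foldr (λ S r → term G U x v S + r) 0ℚ (allSubsets _)
... | no v∉U = x (inj₁ (v , fromWitnessFalse v∉U))

-- The map p is linear, so both inclusions reduce to stable sets.  A stable set T of
-- G⁺ contains at most one node ℓ_S of the clique λ(U), and p sends χ_T to the
-- characteristic vector of (T ∖ λ(U)) ∪ S, which is stable in G because ℓ_S is
-- adjacent to every neighbour of S outside U.  Conversely a stable set I of G lifts to
-- (I ∖ U) ∪ {ℓ_{I ∩ U}}, stable in G⁺ and mapped by p back to χ_I.  Convex
-- combinations are carried along with the same coefficients.
module Submission where

open import Defs hiding (sym)
open import Data.Nat using (ℕ; zero; suc)
open import Data.Fin using (Fin)
open import Data.Fin.Subset using (Subset; _∈_; _∉_; inside; outside; ⊥)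
open import Data.Fin.Subset.Properties using (_∈?_; ∉⊥; anySubset?)
open import Data.Rational using (ℚ; 0ℚ; 1ℚ; _+_; _*_; _≤_)
open import Data.Rational.Properties using (+-identityʳ; +-identityˡ; +-assoc; *-zeroʳ)
open import Data.Rational.Solver using (module +-*-Solver)
open import Data.Product using (Σ; _×_; _,_; proj₁; proj₂; map₂)
open import Data.Sum using (_⊎_; inj₁; inj₂)
open import Data.Bool using (Bool; true; false; if_then_else_; _∧_)
open import Data.Bool.Properties using (¬-not; ∧-identityʳ) renaming (_≟_ to _≟ᵇ_)
open import Data.List using (List; []; _∷_; map; foldr; concatMap)
open import Data.List.Properties using (map-id)
open import Data.List.Relation.Unary.All using (All)
open import Data.List.Relation.Unary.All.Properties using (map⁺)
open import Data.Vec using (lookup; tabulate; _∷_; [])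
open import Data.Vec.Properties using (≡-dec; ∷-injectiveʳ; []=⇒lookup; lookup⇒[]=; lookup∘tabulate)
open import Function using (id; _∘_; case_of_)
open import Relation.Nullary using (Dec; yes; no; does)
open import Relation.Nullary.Decidable using (True; toWitness; fromWitness; fromWitnessFalse; dec-true; dec-false; decidable-stable)
open import Relation.Binary.Definitions using (DecidableEquality)
open import Relation.Binary.PropositionalEquality
open import Data.Empty using (⊥-elim)

_≟ˢ_ : ∀ {n} → DecidableEquality (Subset n)
_≟ˢ_ = ≡-dec _≟ᵇ_

c*0+0≡0 : ∀ c → c * 0ℚ + 0ℚ ≡ 0ℚ
c*0+0≡0 c = trans (+-identityʳ (c * 0ℚ)) (*-zeroʳ c)

sumOver : {B : Set} → List B → (B → ℚ) → ℚ
sumOver Ls F = foldr (λ S r → F S + r) 0ℚ Ls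

module _ {B : Set} where

  sumOver-cong : {F F′ : B → ℚ} → F ≗ F′ → ∀ Ls → sumOver Ls F ≡ sumOver Ls F′
  sumOver-cong F≗F′ []       = refl
  sumOver-cong F≗F′ (S ∷ Ls) = cong₂ _+_ (F≗F′ S) (sumOver-cong F≗F′ Ls)

  sumOver-zero : {F : B → ℚ} → F ≗ (λ _ → 0ℚ) → ∀ Ls → sumOver Ls F ≡ 0ℚ
  sumOver-zero F≗0 []       = refl
  sumOver-zero F≗0 (S ∷ Ls) = trans (cong₂ _+_ (F≗0 S) (sumOver-zero F≗0 Ls)) (+-identityʳ 0ℚ)

  sumOver-axpy : (c : ℚ) (F H : B → ℚ) → ∀ Ls →
                 sumOver Ls (λ S → c * F S + H S) ≡ c * sumOver Ls F + sumOver Ls H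
  sumOver-axpy c F H []       = sym (c*0+0≡0 c)
  sumOver-axpy c F H (S ∷ Ls) =
    trans (cong (c * F S + H S +_) (sumOver-axpy c F H Ls))
          (regroup c (F S) (H S) (sumOver Ls F) (sumOver Ls H))
    where
    open +-*-Solver
    regroup : ∀ c a b A B → (c * a + b) + (c * A + B) ≡ c * (a + A) + (b + B)
    regroup = solve 5 (λ c a b A B → (c :* a :+ b) :+ (c :* A :+ B) := c :* (a :+ A) :+ (b :+ B)) refl

sumOver-pairs : ∀ {m} (F : Subset (suc m) → ℚ) (Ls : List (Subset m)) →
  sumOver (concatMap (λ S → (outside ∷ S) ∷ (inside ∷ S) ∷ []) Ls) F
    ≡ sumOver Ls (λ S → F (outside ∷ S) + F (inside ∷ S))
sumOver-pairs F []       = refl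
sumOver-pairs F (S ∷ Ls) =
  trans (sym (+-assoc (F (outside ∷ S)) (F (inside ∷ S)) _))
        (cong (F (outside ∷ S) + F (inside ∷ S) +_) (sumOver-pairs F Ls))

sumOver-allSubsets-single : ∀ {m} (S₀ : Subset m) (F : Subset m → ℚ) →
  (∀ S → S ≢ S₀ → F S ≡ 0ℚ) → sumOver (allSubsets m) F ≡ F S₀
sumOver-allSubsets-single {zero}  []       F F≡0 = +-identityʳ (F [])
sumOver-allSubsets-single {suc m} (b ∷ S₀) F F≡0 = begin
  sumOver (allSubsets (suc m)) F  ≡⟨ sumOver-pairs F (allSubsets m) ⟩
  sumOver (allSubsets m) F₂       ≡⟨ sumOver-allSubsets-single S₀ F₂ F₂≡0 ⟩
  F₂ S₀                           ≡⟨ F₂-at b F≡0 ⟩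
  F (b ∷ S₀)                      ∎
  where
  open ≡-Reasoning
  F₂ : Subset m → ℚ
  F₂ S = F (outside ∷ S) + F (inside ∷ S)
  F₂≡0 : ∀ S → S ≢ S₀ → F₂ S ≡ 0ℚ
  F₂≡0 S S≢S₀ = trans (cong₂ _+_ (F≡0 _ (S≢S₀ ∘ ∷-injectiveʳ)) (F≡0 _ (S≢S₀ ∘ ∷-injectiveʳ)))
                      (+-identityʳ 0ℚ)
  F₂-at : ∀ b → (∀ S → S ≢ b ∷ S₀ → F S ≡ 0ℚ) → F₂ S₀ ≡ F (b ∷ S₀)
  F₂-at outside F≡0 = trans (cong (F (outside ∷ S₀) +_) (F≡0 _ λ ())) (+-identityʳ _)
  F₂-at inside  F≡0 = trans (cong (_+ F (inside ∷ S₀)) (F≡0 _ λ ())) (+-identityˡ _)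

record IsLinear {A B : Set} (F : (A → ℚ) → B → ℚ) : Set where
  field
    cong-≗   : {f g : A → ℚ} → f ≗ g → F f ≗ F g
    map-0    : F (λ _ → 0ℚ) ≗ (λ _ → 0ℚ)
    map-axpy : (c : ℚ) (f g : A → ℚ) → F (λ a → c * f a + g a) ≗ (λ b → c * F f b + F g b)

sumCoeff-map₂ : {C D : Set} (φ : C → D) (L : List (ℚ × C)) → sumCoeff (map (map₂ φ) L) ≡ sumCoeff L
sumCoeff-map₂ φ []      = refl
sumCoeff-map₂ φ (q ∷ L) = cong (proj₁ q +_) (sumCoeff-map₂ φ L)

module _ {A : Set} {Adj : A → A → Set} {C : Set} (φ : C → StableSet Adj) where

  combo-InP : (L : List (ℚ × C)) → All (λ q → 0ℚ ≤ proj₁ q) L → sumCoeff L ≡ 1ℚ →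
              InP Adj (combo (map (map₂ φ) L))
  combo-InP L nonneg sum≡1 = map (map₂ φ) L , map⁺ nonneg , trans (sumCoeff-map₂ φ L) sum≡1 , λ _ → refl

module _ {A B : Set} {AdjA : A → A → Set} {AdjB : B → B → Set}
         {F : (A → ℚ) → B → ℚ} (F-linear : IsLinear F) where

  private module F = IsLinear F-linear

  F-combo : {C : Set} (ψ : C → StableSet AdjA) (φ : C → StableSet AdjB) →
            (∀ c → F (χ (proj₁ (ψ c))) ≗ χ (proj₁ (φ c))) →
            ∀ L → F (combo (map (map₂ ψ) L)) ≗ combo (map (map₂ φ) L)
  F-combo ψ φ F-χ []            = F.map-0
  F-combo ψ φ F-χ ((c , t) ∷ L) b =
    trans (F.map-axpy c (χ (proj₁ (ψ t))) (combo (map (map₂ ψ) L)) b)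
          (cong₂ (λ x y → c * x + y) (F-χ t b) (F-combo ψ φ F-χ L b))

  InP-image : (φ : StableSet AdjA → StableSet AdjB) →
              (∀ T → F (χ (proj₁ T)) ≗ χ (proj₁ (φ T))) →
              {y : A → ℚ} → InP AdjA y → InP AdjB (F y)
  InP-image φ F-χ (L , nonneg , sum≡1 , y≗) =
    let (L′ , nonneg′ , sum≡1′ , _) = combo-InP φ L nonneg sum≡1 in
    L′ , nonneg′ , sum≡1′ ,
    λ b → trans (F.cong-≗ (λ a → trans (y≗ a) (cong (λ L → combo L a) (sym (map-id L)))) b)
                (F-combo id φ F-χ L b)

  InP-section : (σ : StableSet AdjB → StableSet AdjA) →
                (∀ T → F (χ (proj₁ (σ T))) ≗ χ (proj₁ T)) →
                {x : B → ℚ} → InP AdjB x → Σ (A → ℚ) λ y → InP AdjA y × (F y ≗ x)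
  InP-section σ F-χσ (L , nonneg , sum≡1 , x≗) =
    combo (map (map₂ σ) L) , combo-InP σ L nonneg sum≡1 ,
    λ b → trans (F-combo σ id F-χσ L b) (trans (cong (λ L → combo L b) (map-id L)) (sym (x≗ b)))

χ-∈ : ∀ {n} {S : Subset n} {v} → v ∈ S → χ (lookup S) v ≡ 1ℚ
χ-∈ v∈S rewrite []=⇒lookup v∈S = refl

χ-∉ : ∀ {n} {S : Subset n} {v} → v ∉ S → χ (lookup S) v ≡ 0ℚ
χ-∉ {S = S} {v} v∉S with lookup S v in eq
... | true  = ⊥-elim (v∉S (lookup⇒[]= v S eq))
... | false = refl

∧-≡-true : ∀ {x y} → x ∧ y ≡ true → x ≡ true × y ≡ true
∧-≡-true {true} {true} refl = refl , refl

module _ {n : ℕ} (G : Graph n) (U : Subset n) where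

  private
    Adj⁺G = Adj⁺ G U
    Node = Node⁺ G U

  term-cong : {f g : Node → ℚ} → f ≗ g → ∀ v S → term G U f v S ≡ term G U g v S
  term-cong f≗g v S with isStableIn? G U S | v ∈? S
  ... | yes _ | yes _ = f≗g _
  ... | yes _ | no _  = refl
  ... | no _  | _     = refl

  term-zero : ∀ v S → term G U (λ _ → 0ℚ) v S ≡ 0ℚ
  term-zero v S with isStableIn? G U S | v ∈? S
  ... | yes _ | yes _ = refl
  ... | yes _ | no _  = refl
  ... | no _  | _     = refl

  term-axpy : (c : ℚ) (f g : Node → ℚ) → ∀ v S →
    term G U (λ a → c * f a + g a) v S ≡ c * term G U f v S + term G U g v S
  term-axpy c f g v S with isStableIn? G U S | v ∈? S
  ... | yes _ | yes _ = refl
  ... | yes _ | no _  = sym (c*0+0≡0 c)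
  ... | no _  | _     = sym (c*0+0≡0 c)

  p-linear : IsLinear (p G U)
  p-linear = record { cong-≗ = p-cong ; map-0 = p-zero ; map-axpy = p-axpy }
    where
    p-cong : {f g : Node → ℚ} → f ≗ g → p G U f ≗ p G U g
    p-cong f≗g v with v ∈? U
    ... | yes _ = sumOver-cong (term-cong f≗g v) (allSubsets n)
    ... | no _  = f≗g _
    p-zero : p G U (λ _ → 0ℚ) ≗ (λ _ → 0ℚ)
    p-zero v with v ∈? U
    ... | yes _ = sumOver-zero (term-zero v) (allSubsets n)
    ... | no _  = refl
    p-axpy : (c : ℚ) (f g : Node → ℚ) → p G U (λ a → c * f a + g a) ≗ (λ v → c * p G U f v + p G U g v)
    p-axpy c f g v with v ∈? U
    ... | yes _ = trans (sumOver-cong (term-axpy c f g v) (allSubsets n))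
                        (sumOver-axpy c (term G U f v) (term G U g v) (allSubsets n))
    ... | no _  = refl

  -- T ∋ℓ S says ℓ_S ∈ T; it is false when S is not stable in G_U, so that ℓ_S does not exist.
  _∋ℓ_ : (Node → Bool) → Subset n → Bool
  T ∋ℓ S with isStableIn? G U S
  ... | yes st = T (inj₂ (S , fromWitness st))
  ... | no _   = false

  ∋ℓ-node : ∀ T S → T ∋ℓ S ≡ true → Σ (LamU G U) λ a → proj₁ a ≡ S × T (inj₂ a) ≡ true
  ∋ℓ-node T S e with isStableIn? G U S
  ... | yes st = (S , fromWitness st) , refl , e

  ∋ℓ-unique : ∀ {T} → IsStable Adj⁺G T → ∀ S S′ → T ∋ℓ S ≡ true → T ∋ℓ S′ ≡ true → S ≡ S′
  ∋ℓ-unique {T} stT S S′ e e′ with ∋ℓ-node T S e | ∋ℓ-node T S′ e′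
  ... | _ , refl , ℓ∈T | _ , refl , ℓ′∈T = decidable-stable (S ≟ˢ S′) (stT _ _ ℓ∈T ℓ′∈T)

  term-χ-off : ∀ T {v S} → T ∋ℓ S ≡ false → term G U (χ T) v S ≡ 0ℚ
  term-χ-off T {v} {S} e with isStableIn? G U S | v ∈? S
  ... | yes _ | yes _ rewrite e = refl
  ... | yes _ | no _  = refl
  ... | no _  | _     = refl

  term-χ-on : ∀ T {v S} → T ∋ℓ S ≡ true → v ∈ S → term G U (χ T) v S ≡ 1ℚ
  term-χ-on T {v} {S} e v∈S with isStableIn? G U S | v ∈? S
  ... | yes _ | yes _   rewrite e = refl
  ... | yes _ | no v∉S  = ⊥-elim (v∉S v∈S)

  term-∉ : ∀ x {v S} → v ∉ S → term G U x v S ≡ 0ℚ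
  term-∉ x {v} {S} v∉S with isStableIn? G U S | v ∈? S
  ... | yes _ | yes v∈S = ⊥-elim (v∉S v∈S)
  ... | yes _ | no _    = refl
  ... | no _  | _       = refl

  -- S₀ = ∅ also covers the stable sets of G⁺ that avoid λ(U).
  LambdaPart : (Node → Bool) → Subset n → Set
  LambdaPart T S₀ = (∀ S → S ≢ S₀ → T ∋ℓ S ≡ false) × (T ∋ℓ S₀ ≡ true ⊎ S₀ ≡ ⊥)

  lambdaPart : ∀ {T} → IsStable Adj⁺G T → Σ (Subset n) (LambdaPart T)
  lambdaPart {T} stT with anySubset? (λ S → T ∋ℓ S ≟ᵇ true)
  ... | yes (S₀ , e) = S₀ , (λ S S≢S₀ → ¬-not (S≢S₀ ∘ λ e′ → ∋ℓ-unique stT S S₀ e′ e)) , inj₁ e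
  ... | no none      = ⊥ , (λ S _ → ¬-not (none ∘ (S ,_))) , inj₂ refl

  -- (T ∖ λ(U)) ∪ S₀, as a set of nodes of G.
  unlift : Subset n → (Node → Bool) → Fin n → Bool
  unlift S₀ T v with v ∈? U
  ... | yes _   = lookup S₀ v
  ... | no v∉U  = T (inj₁ (v , fromWitnessFalse v∉U))

  term-χ-anchor : ∀ T {S₀} v → T ∋ℓ S₀ ≡ true ⊎ S₀ ≡ ⊥ → term G U (χ T) v S₀ ≡ χ (lookup S₀) v
  term-χ-anchor T {S₀} v anchor = by-membership anchor (v ∈? S₀)
    where
    by-membership : T ∋ℓ S₀ ≡ true ⊎ S₀ ≡ ⊥ → Dec (v ∈ S₀) → term G U (χ T) v S₀ ≡ χ (lookup S₀) v
    by-membership _           (no v∉S₀)  = trans (term-∉ (χ T) v∉S₀) (sym (χ-∉ v∉S₀))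
    by-membership (inj₁ ℓ∈T)  (yes v∈S₀) = trans (term-χ-on T ℓ∈T v∈S₀) (sym (χ-∈ v∈S₀))
    by-membership (inj₂ S₀≡⊥) (yes v∈S₀) = ⊥-elim (∉⊥ (subst (v ∈_) S₀≡⊥ v∈S₀))

  p-χ : ∀ {T S₀} → LambdaPart T S₀ → p G U (χ T) ≗ χ (unlift S₀ T)
  p-χ {T} {S₀} (off , anchor) v with v ∈? U
  ... | no _  = refl
  ... | yes _ = trans (sumOver-allSubsets-single S₀ (term G U (χ T) v) (λ S → term-χ-off T {v} {S} ∘ off S))
                      (term-χ-anchor T v anchor)

  anchor-∈ : ∀ {T S₀ s} → T ∋ℓ S₀ ≡ true ⊎ S₀ ≡ ⊥ → s ∈ S₀ →
             Σ (True (isStableIn? G U S₀)) λ w → T (inj₂ (S₀ , w)) ≡ true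
  anchor-∈ {T} {S₀} (inj₁ ℓ∈T) _ with ∋ℓ-node T S₀ ℓ∈T
  ... | (_ , w) , refl , ℓ∈T′ = w , ℓ∈T′
  anchor-∈ (inj₂ refl) s∈⊥ = ⊥-elim (∉⊥ s∈⊥)

  unlift-stable : ∀ {T S₀} → IsStable Adj⁺G T → T ∋ℓ S₀ ≡ true ⊎ S₀ ≡ ⊥ →
                  IsStable (AdjG G) (unlift S₀ T)
  unlift-stable {T} {S₀} stT anchor a b ea eb ab with a ∈? U | b ∈? U
  ... | no _  | no _  = stT _ _ ea eb ab
  ... | yes _ | yes _ = let (w , _) = anchor-∈ anchor a∈S₀ in
                        case trans (sym ab) (proj₂ (toWitness w) a b a∈S₀ (lookup⇒[]= b S₀ eb)) of λ ()
    where a∈S₀ = lookup⇒[]= a S₀ ea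
  ... | yes _ | no _  = let (_ , ℓ∈T) = anchor-∈ anchor a∈S₀ in stT _ _ ℓ∈T eb (a , a∈S₀ , ab)
    where a∈S₀ = lookup⇒[]= a S₀ ea
  ... | no _  | yes _ = let (_ , ℓ∈T) = anchor-∈ anchor b∈S₀ in
                        stT _ _ ea ℓ∈T (b , b∈S₀ , trans (Graph.sym G b a) ab)
    where b∈S₀ = lookup⇒[]= b S₀ eb

  project : StableSet Adj⁺G → StableSet (AdjG G)
  project (T , stT) = unlift (proj₁ (lambdaPart stT)) T , unlift-stable stT (proj₂ (proj₂ (lambdaPart stT)))

  p-χ-project : ∀ T → p G U (χ (proj₁ T)) ≗ χ (proj₁ (project T))
  p-χ-project (T , stT) = p-χ (proj₂ (lambdaPart stT))

  traceU : (Fin n → Bool) → Subset n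
  traceU I = tabulate (λ v → I v ∧ lookup U v)

  ∈-traceU : ∀ I {s} → s ∈ traceU I → I s ≡ true × s ∈ U
  ∈-traceU I {s} s∈ with ∧-≡-true (trans (sym (lookup∘tabulate _ s)) ([]=⇒lookup s∈))
  ... | Is , Us = Is , lookup⇒[]= s U Us

  traceU-stable : ∀ {I} → IsStable (AdjG G) I → IsStableIn G U (traceU I)
  traceU-stable {I} stI = proj₂ ∘ ∈-traceU I
                        , λ u v u∈ v∈ → ¬-not (stI u v (proj₁ (∈-traceU I u∈)) (proj₁ (∈-traceU I v∈)))

  lift : (Fin n → Bool) → Node → Bool
  lift I (inj₁ (v , _)) = I v
  lift I (inj₂ (S , _)) = does (S ≟ˢ traceU I)

  is-traceU : ∀ {I S} → does (S ≟ˢ traceU I) ≡ true → S ≡ traceU I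
  is-traceU {I} {S} with S ≟ˢ traceU I
  ... | yes S≡traceU = λ _ → S≡traceU

  lift-stable : ∀ {I} → IsStable (AdjG G) I → IsStable Adj⁺G (lift I)
  lift-stable stI (inj₁ _) (inj₁ _) eu ev u~v = stI _ _ eu ev u~v
  lift-stable stI (inj₂ (S , _)) (inj₂ (S′ , _)) eS eS′ S≢S′ =
    S≢S′ (trans (is-traceU eS) (sym (is-traceU eS′)))
  lift-stable {I} stI (inj₂ _) (inj₁ _) eS ev (s , s∈S , s~v) =
    stI _ _ (proj₁ (∈-traceU I (subst (s ∈_) (is-traceU eS) s∈S))) ev s~v
  lift-stable {I} stI (inj₁ _) (inj₂ _) ev eS (s , s∈S , s~v) =
    stI _ _ (proj₁ (∈-traceU I (subst (s ∈_) (is-traceU eS) s∈S))) ev s~v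

  lift-lambdaPart : ∀ {I} → IsStable (AdjG G) I → LambdaPart (lift I) (traceU I)
  lift-lambdaPart {I} stI = off , inj₁ on
    where
    off : ∀ S → S ≢ traceU I → lift I ∋ℓ S ≡ false
    off S S≢ with isStableIn? G U S
    ... | yes _ = dec-false (S ≟ˢ traceU I) S≢
    ... | no _  = refl
    on : lift I ∋ℓ traceU I ≡ true
    on with isStableIn? G U (traceU I)
    ... | yes _     = dec-true (traceU I ≟ˢ traceU I) refl
    ... | no ¬stable = ⊥-elim (¬stable (traceU-stable stI))

  unlift-lift : ∀ I → unlift (traceU I) (lift I) ≗ I
  unlift-lift I v with v ∈? U
  ... | no _    = refl
  ... | yes v∈U = trans (lookup∘tabulate _ v) (trans (cong (I v ∧_) ([]=⇒lookup v∈U)) (∧-identityʳ (I v)))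

  liftStable : StableSet (AdjG G) → StableSet Adj⁺G
  liftStable (I , stI) = lift I , lift-stable stI

  p-χ-lift : ∀ I → p G U (χ (proj₁ (liftStable I))) ≗ χ (proj₁ I)
  p-χ-lift (I , stI) v = trans (p-χ (lift-lambdaPart stI) v) (cong (λ b → if b then 1ℚ else 0ℚ) (unlift-lift I v))

lemma9 : (n : ℕ) (G : Graph n) (U : Subset n) (x : Fin n → ℚ) →
    (P G x → Σ (Node⁺ G U → ℚ) (λ y → P⁺ G U y × (∀ v → p G U y v ≡ x v)))
    × ((y : Node⁺ G U → ℚ) → P⁺ G U y → P G (p G U y))
lemma9 n G U x = InP-section (p-linear G U) (liftStable G U) (p-χ-lift G U)
               , λ y → InP-image (p-linear G U) (project G U) (p-χ-project G U)
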